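{- Let $d_\ell(m)=2^{ -2m}\sum_{k=\ell}^m 2^k \binom{2m-2k}{m-k}\binom{m+k}{k}\binom{k}{\ell}$ for integers $m\geq \ell\geq 0$. For every $m\geq 2$ and $1\leq \ell\leq m-1$, \[ \frac{d_\ell(m)^2}{d_{\ell-1}(m)d_{\ell+1}(m)}>\frac{(m-\ell+1)(\ell+1)(m+\ell+\ell^2)}{(m-\ell)\ell(m+\ell+\ell^2+1)}. \]
   Context: The numbers $d_\ell(m)$ are the Boros–Moll coefficients (coefficients of $x^\ell$ in the Boros–Moll polynomial $P_m(x)$); they are positive for $0\le \ell\le m$. -}

module Defs where

open import Data.Nat using (ℕ; zero; suc; _+_; _*_; _∸_; _^_)
open import Data.Nat.Combinatorics using (_C_)
open import Data.List using (List; map; upTo)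
open import Data.Nat.ListAction using (sum)
open import Data.Nat.Properties using (m^n≢0)
open import Data.Rational using (ℚ; _/_)
import Data.Integer as ℤ

term : ℕ → ℕ → ℕ → ℕ
term m ℓ k = 2 ^ k * ((2 * m ∸ 2 * k) C (m ∸ k)) * ((m + k) C k) * (k C ℓ)

numer : ℕ → ℕ → ℕ
numer ℓ m = sum (map (λ j → term m ℓ (ℓ + j)) (upTo (suc (m ∸ ℓ))))

d : ℕ → ℕ → ℚ
d ℓ m = _/_ (ℤ.+ (numer ℓ m)) (2 ^ (2 * m)) {{m^n≢0 2 (2 * m)}}

ι : ℕ → ℚ
ι n = ℤ.+ n / 1

-- Write Nₗ = 2^(2m) dₗ(m). A telescoping certificate proves the three-term recurrence
--   ℓ(ℓ+1) Nₗ₊₁ + (m+ℓ)(m+1-ℓ) Nₗ₋₁ = (2m+1) ℓ Nₗ.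
-- Running it downward from ℓ = m, where Nₘ₊₁ = 0, yields by induction an explicit rational upper
-- bound for Nₗ₊₁ / Nₗ; each induction step reduces to a polynomial inequality in m - ℓ and ℓ whose
-- coefficients can be compared one by one. Eliminating Nₗ₋₁ with the recurrence turns the claim
-- into the positivity of a quadratic form in (Nₗ, Nₗ₊₁), which holds on the region cut out by
-- that bound, again by coefficientwise polynomial inequalities.

module Submission where

module Polynomial where

  open import Data.Nat
  open import Data.Nat.Properties
  open import Data.Bool using (Bool; true; _∧_; T)
  open import Data.Bool.Properties using (T-∧)
  open import Data.Fin using (Fin; zero; suc)
  open import Data.List using (List; []; _∷_)
  open import Data.Vec using (Vec; []; _∷_; lookup)
  open import Data.Product using (_,_)
  open import Function.Bundles using (Equivalence)
  open import Relation.Binary.PropositionalEquality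
  open import Data.Nat.Tactic.RingSolver using (solve-∀)

  -- Horner form: Poly (suc n) lists the coefficients (in Poly n) of the powers of the first variable.
  -- As variables range over ℕ, comparing coefficients is a sound test for ≤ of the values.
  Poly : ℕ → Set
  Poly zero = ℕ
  Poly (suc n) = List (Poly n)

  ⟦_⟧ₚ : ∀ {n} → Poly n → Vec ℕ n → ℕ
  ⟦_⟧ₚ {zero} c [] = c
  ⟦_⟧ₚ {suc n} [] (x ∷ ρ) = 0
  ⟦_⟧ₚ {suc n} (c ∷ p) (x ∷ ρ) = ⟦ c ⟧ₚ ρ + x * ⟦ p ⟧ₚ (x ∷ ρ)

  constₚ : ∀ {n} → ℕ → Poly n
  constₚ {zero} c = c
  constₚ {suc n} c = constₚ c ∷ []

  varₚ : ∀ {n} → Fin n → Poly n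
  varₚ {suc n} zero = constₚ 0 ∷ constₚ 1 ∷ []
  varₚ {suc n} (suc i) = varₚ i ∷ []

  infixl 6 _+ₚ_
  infixl 7 _*ₚ_

  _+ₚ_ : ∀ {n} → Poly n → Poly n → Poly n
  _+ₚ_ {zero} a b = a + b
  _+ₚ_ {suc n} [] q = q
  _+ₚ_ {suc n} (c ∷ p) [] = c ∷ p
  _+ₚ_ {suc n} (c ∷ p) (d ∷ q) = (c +ₚ d) ∷ (p +ₚ q)

  mutual
    _*ₚ_ : ∀ {n} → Poly n → Poly n → Poly n
    _*ₚ_ {zero} a b = a * b
    _*ₚ_ {suc n} [] q = []
    _*ₚ_ {suc n} (c ∷ p) q = scaleₚ c q +ₚ (constₚ 0 ∷ p *ₚ q)

    scaleₚ : ∀ {n} → Poly n → Poly (suc n) → Poly (suc n)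
    scaleₚ c [] = []
    scaleₚ c (d ∷ q) = c *ₚ d ∷ scaleₚ c q

  _≤ᶜ_ : ∀ {n} → Poly n → Poly n → Bool
  _≤ᶜ_ {zero} a b = a ≤ᵇ b
  _≤ᶜ_ {suc n} [] q = true
  _≤ᶜ_ {suc n} (c ∷ p) [] = (c ≤ᶜ constₚ 0) ∧ (p ≤ᶜ [])
  _≤ᶜ_ {suc n} (c ∷ p) (d ∷ q) = (c ≤ᶜ d) ∧ (p ≤ᶜ q)

  ⟦const⟧ : ∀ {n} c (ρ : Vec ℕ n) → ⟦ constₚ c ⟧ₚ ρ ≡ c
  ⟦const⟧ {zero} c [] = refl
  ⟦const⟧ {suc n} c (x ∷ ρ) rewrite ⟦const⟧ c ρ | *-zeroʳ x = +-identityʳ c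

  ⟦var⟧ : ∀ {n} i (ρ : Vec ℕ n) → ⟦ varₚ i ⟧ₚ ρ ≡ lookup ρ i
  ⟦var⟧ {suc n} zero (x ∷ ρ) rewrite ⟦const⟧ 0 ρ | ⟦const⟧ 1 ρ | *-zeroʳ x = *-identityʳ x
  ⟦var⟧ {suc n} (suc i) (x ∷ ρ) rewrite ⟦var⟧ i ρ | *-zeroʳ x = +-identityʳ (lookup ρ i)

  ⟦+⟧ : ∀ {n} (p q : Poly n) ρ → ⟦ p +ₚ q ⟧ₚ ρ ≡ ⟦ p ⟧ₚ ρ + ⟦ q ⟧ₚ ρ
  ⟦+⟧ {zero} a b [] = refl
  ⟦+⟧ {suc n} [] q (x ∷ ρ) = refl
  ⟦+⟧ {suc n} (c ∷ p) [] (x ∷ ρ) = sym (+-identityʳ _)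
  ⟦+⟧ {suc n} (c ∷ p) (d ∷ q) (x ∷ ρ) rewrite ⟦+⟧ c d ρ | ⟦+⟧ p q (x ∷ ρ) =
    shuffle (⟦ c ⟧ₚ ρ) (⟦ d ⟧ₚ ρ) x (⟦ p ⟧ₚ (x ∷ ρ)) (⟦ q ⟧ₚ (x ∷ ρ))
    where
    shuffle : ∀ c d x p q → c + d + x * (p + q) ≡ c + x * p + (d + x * q)
    shuffle = solve-∀

  mutual
    ⟦*⟧ : ∀ {n} (p q : Poly n) ρ → ⟦ p *ₚ q ⟧ₚ ρ ≡ ⟦ p ⟧ₚ ρ * ⟦ q ⟧ₚ ρ
    ⟦*⟧ {zero} a b [] = refl
    ⟦*⟧ {suc n} [] q (x ∷ ρ) = refl
    ⟦*⟧ {suc n} (c ∷ p) q (x ∷ ρ)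
      rewrite ⟦+⟧ (scaleₚ c q) (constₚ 0 ∷ p *ₚ q) (x ∷ ρ) | ⟦scale⟧ c q x ρ
            | ⟦const⟧ 0 ρ | ⟦*⟧ p q (x ∷ ρ) =
      distrib (⟦ c ⟧ₚ ρ) x (⟦ p ⟧ₚ (x ∷ ρ)) (⟦ q ⟧ₚ (x ∷ ρ))
      where
      distrib : ∀ c x p q → c * q + x * (p * q) ≡ (c + x * p) * q
      distrib = solve-∀

    ⟦scale⟧ : ∀ {n} c (q : Poly (suc n)) x ρ → ⟦ scaleₚ c q ⟧ₚ (x ∷ ρ) ≡ ⟦ c ⟧ₚ ρ * ⟦ q ⟧ₚ (x ∷ ρ)
    ⟦scale⟧ c [] x ρ = sym (*-zeroʳ (⟦ c ⟧ₚ ρ))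
    ⟦scale⟧ c (d ∷ q) x ρ rewrite ⟦*⟧ c d ρ | ⟦scale⟧ c q x ρ =
      distrib (⟦ c ⟧ₚ ρ) x (⟦ d ⟧ₚ ρ) (⟦ q ⟧ₚ (x ∷ ρ))
      where
      distrib : ∀ c x d q → c * d + x * (c * q) ≡ c * (d + x * q)
      distrib = solve-∀

  ≤ᶜ-sound : ∀ {n} (p q : Poly n) → T (p ≤ᶜ q) → ∀ ρ → ⟦ p ⟧ₚ ρ ≤ ⟦ q ⟧ₚ ρ
  ≤ᶜ-sound {zero} a b a≤b [] = ≤ᵇ⇒≤ a b a≤b
  ≤ᶜ-sound {suc n} [] q _ (x ∷ ρ) = z≤n
  ≤ᶜ-sound {suc n} (c ∷ p) [] c,p≤0 (x ∷ ρ) with Equivalence.to T-∧ c,p≤0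
  ... | c≤0 , p≤0 = +-mono-≤ (subst (⟦ c ⟧ₚ ρ ≤_) (⟦const⟧ 0 ρ) (≤ᶜ-sound c (constₚ 0) c≤0 ρ))
                             (subst (x * ⟦ p ⟧ₚ (x ∷ ρ) ≤_) (*-zeroʳ x) (*-monoʳ-≤ x (≤ᶜ-sound p [] p≤0 (x ∷ ρ))))
  ≤ᶜ-sound {suc n} (c ∷ p) (d ∷ q) c,p≤d,q (x ∷ ρ) with Equivalence.to T-∧ c,p≤d,q
  ... | c≤d , p≤q = +-mono-≤ (≤ᶜ-sound c d c≤d ρ) (*-monoʳ-≤ x (≤ᶜ-sound p q p≤q (x ∷ ρ)))

  infixl 6 _⊕_
  infixl 7 _⊗_

  data Expr (n : ℕ) : Set where
    var : Fin n → Expr n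
    con : ℕ → Expr n
    _⊕_ _⊗_ : Expr n → Expr n → Expr n

  ⟦_⟧ : ∀ {n} → Expr n → Vec ℕ n → ℕ
  ⟦ var i ⟧ ρ = lookup ρ i
  ⟦ con c ⟧ ρ = c
  ⟦ e ⊕ f ⟧ ρ = ⟦ e ⟧ ρ + ⟦ f ⟧ ρ
  ⟦ e ⊗ f ⟧ ρ = ⟦ e ⟧ ρ * ⟦ f ⟧ ρ

  normalize : ∀ {n} → Expr n → Poly n
  normalize (var i) = varₚ i
  normalize (con c) = constₚ c
  normalize (e ⊕ f) = normalize e +ₚ normalize f
  normalize (e ⊗ f) = normalize e *ₚ normalize f

  normalize-sound : ∀ {n} (e : Expr n) ρ → ⟦ normalize e ⟧ₚ ρ ≡ ⟦ e ⟧ ρ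
  normalize-sound (var i) ρ = ⟦var⟧ i ρ
  normalize-sound (con c) ρ = ⟦const⟧ c ρ
  normalize-sound (e ⊕ f) ρ = trans (⟦+⟧ (normalize e) (normalize f) ρ) (cong₂ _+_ (normalize-sound e ρ) (normalize-sound f ρ))
  normalize-sound (e ⊗ f) ρ = trans (⟦*⟧ (normalize e) (normalize f) ρ) (cong₂ _*_ (normalize-sound e ρ) (normalize-sound f ρ))

  ≤-by-coefficients : ∀ {n} (e f : Expr n) → T (normalize e ≤ᶜ normalize f) → ∀ ρ → ⟦ e ⟧ ρ ≤ ⟦ f ⟧ ρ
  ≤-by-coefficients e f e≤f ρ =
    subst₂ _≤_ (normalize-sound e ρ) (normalize-sound f ρ) (≤ᶜ-sound (normalize e) (normalize f) e≤f ρ)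


module FiniteSum where

  open import Data.Nat
  open import Data.Nat.Properties
  open import Data.List using (map; applyUpTo)
  open import Data.Nat.ListAction using (sum)
  open import Relation.Binary.PropositionalEquality
  open import Data.Nat.Tactic.RingSolver using (solve-∀)

  ∑ : ℕ → (ℕ → ℕ) → ℕ
  ∑ zero f = 0
  ∑ (suc n) f = f 0 + ∑ n (λ k → f (suc k))

  syntax ∑ n (λ k → e) = ∑[ k < n ] e

  sum-map-applyUpTo : ∀ n (f g : ℕ → ℕ) → sum (map f (applyUpTo g n)) ≡ ∑[ k < n ] f (g k)
  sum-map-applyUpTo zero f g = refl
  sum-map-applyUpTo (suc n) f g = cong (f (g 0) +_) (sum-map-applyUpTo n f (λ k → g (suc k)))

  ∑-+ : ∀ n (f g : ℕ → ℕ) → ∑[ k < n ] (f k + g k) ≡ ∑ n f + ∑ n g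
  ∑-+ zero f g = refl
  ∑-+ (suc n) f g rewrite ∑-+ n (λ k → f (suc k)) (λ k → g (suc k)) =
    shuffle (f 0) (g 0) (∑[ k < n ] f (suc k)) (∑[ k < n ] g (suc k))
    where
    shuffle : ∀ a b c d → a + b + (c + d) ≡ a + c + (b + d)
    shuffle = solve-∀

  ∑-*ˡ : ∀ n c (f : ℕ → ℕ) → ∑[ k < n ] (c * f k) ≡ c * ∑ n f
  ∑-*ˡ zero c f = sym (*-zeroʳ c)
  ∑-*ˡ (suc n) c f rewrite ∑-*ˡ n c (λ k → f (suc k)) = sym (*-distribˡ-+ c (f 0) _)

  ∑-split : ∀ a n (f : ℕ → ℕ) → ∑ (a + n) f ≡ ∑ a f + ∑[ k < n ] f (a + k)
  ∑-split zero n f = refl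
  ∑-split (suc a) n f rewrite ∑-split a n (λ k → f (suc k)) = sym (+-assoc (f 0) _ _)

  ∑-zero : ∀ n (f : ℕ → ℕ) → (∀ k → k < n → f k ≡ 0) → ∑ n f ≡ 0
  ∑-zero zero f _ = refl
  ∑-zero (suc n) f f≡0 rewrite f≡0 0 z<s = ∑-zero n (λ k → f (suc k)) (λ k k<n → f≡0 (suc k) (s<s k<n))

  telescoping : ∀ n (a b g : ℕ → ℕ) → (∀ k → k < n → a k + g k ≡ b k + g (suc k)) →
                ∑ n a + g 0 ≡ ∑ n b + g n
  telescoping zero a b g _ = refl
  telescoping (suc n) a b g step = begin
      a 0 + A + g 0    ≡⟨ move-left (a 0) A (g 0) ⟩
      A + (a 0 + g 0)  ≡⟨ cong (A +_) (step 0 z<s) ⟩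
      A + (b 0 + g 1)  ≡⟨ move-right A (b 0) (g 1) ⟩
      b 0 + (A + g 1)  ≡⟨ cong (b 0 +_) (telescoping n _ _ (λ k → g (suc k)) (λ k k<n → step (suc k) (s<s k<n))) ⟩
      b 0 + (B + g (suc n)) ≡⟨ sym (+-assoc (b 0) B _) ⟩
      b 0 + B + g (suc n) ∎
    where
    open ≡-Reasoning
    A = ∑[ k < n ] a (suc k)
    B = ∑[ k < n ] b (suc k)
    move-left : ∀ x y z → x + y + z ≡ y + (x + z)
    move-left = solve-∀
    move-right : ∀ x y z → x + (y + z) ≡ y + (x + z)
    move-right = solve-∀


module Binomial where

  open import Data.Nat
  open import Data.Nat.Properties
  open import Data.Nat.Combinatorics
  open import Relation.Binary.PropositionalEquality
  open import Data.Nat.Tactic.RingSolver using (solve-∀)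

  pascal : ∀ n k → n C k + n C suc k ≡ suc n C suc k
  pascal = nCk+nC[k+1]≡[n+1]C[k+1]

  absorption : ∀ n k → suc k * (suc n C suc k) ≡ suc n * (n C k)
  absorption zero zero = refl
  absorption zero (suc k)
    rewrite k>n⇒nCk≡0 {1} {suc (suc k)} (s<s z<s) | k>n⇒nCk≡0 {0} {suc k} z<s = *-zeroʳ (suc (suc k))
  absorption (suc n) zero rewrite nC1≡n (suc (suc n)) = *-comm 1 (suc (suc n))
  absorption (suc n) (suc k) = begin
      suc (suc k) * (suc (suc n) C suc (suc k))
    ≡⟨ cong (suc (suc k) *_) (sym (pascal (suc n) (suc k))) ⟩
      suc (suc k) * (suc n C suc k + suc n C suc (suc k))
    ≡⟨ *-distribˡ-+ (suc (suc k)) (suc n C suc k) _ ⟩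
      (suc n C suc k + suc k * (suc n C suc k)) + suc (suc k) * (suc n C suc (suc k))
    ≡⟨ cong₂ (λ u v → (suc n C suc k + u) + v) (absorption n k) (absorption n (suc k)) ⟩
      (suc n C suc k + suc n * (n C k)) + suc n * (n C suc k)
    ≡⟨ +-assoc (suc n C suc k) _ _ ⟩
      suc n C suc k + (suc n * (n C k) + suc n * (n C suc k))
    ≡⟨ cong (suc n C suc k +_) (trans (sym (*-distribˡ-+ (suc n) (n C k) _)) (cong (suc n *_) (pascal n k))) ⟩
      suc (suc n) * (suc n C suc k)
    ∎
    where open ≡-Reasoning

  [k+1]*nC[k+1]≡[n∸k]*nCk : ∀ n k → suc k * (n C suc k) ≡ (n ∸ k) * (n C k)
  [k+1]*nC[k+1]≡[n∸k]*nCk n k = begin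
      suc k * (n C suc k)
    ≡⟨ sym (m+n∸n≡m _ (suc k * (n C k))) ⟩
      suc k * (n C suc k) + suc k * (n C k) ∸ suc k * (n C k)
    ≡⟨ cong (_∸ suc k * (n C k)) sum-of-both ⟩
      suc n * (n C k) ∸ suc k * (n C k)
    ≡⟨ sym (*-distribʳ-∸ (n C k) (suc n) (suc k)) ⟩
      (n ∸ k) * (n C k)
    ∎
    where
    open ≡-Reasoning
    sum-of-both : suc k * (n C suc k) + suc k * (n C k) ≡ suc n * (n C k)
    sum-of-both = begin
        suc k * (n C suc k) + suc k * (n C k)
      ≡⟨ +-comm (suc k * (n C suc k)) _ ⟩
        suc k * (n C k) + suc k * (n C suc k)
      ≡⟨ sym (*-distribˡ-+ (suc k) (n C k) _) ⟩
        suc k * (n C k + n C suc k)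
      ≡⟨ cong (suc k *_) (pascal n k) ⟩
        suc k * (suc n C suc k)
      ≡⟨ absorption n k ⟩
        suc n * (n C k)
      ∎

  nCk>0 : ∀ n k → k ≤ n → 0 < n C k
  nCk>0 n zero _ = z<s
  nCk>0 (suc n) (suc k) (s≤s k≤n) rewrite sym (pascal n k) = ≤-trans (nCk>0 n k k≤n) (m≤m+n (n C k) _)

  central-binomial : ∀ r → suc r * ((2 + 2 * r) C suc r) ≡ 2 * (1 + 2 * r) * ((2 * r) C r)
  central-binomial r = begin
      suc r * (suc (suc n) C suc r)
    ≡⟨ absorption (suc n) r ⟩
      suc (suc n) * (suc n C r)
    ≡⟨ cong (suc (suc n) *_) symmetric ⟩
      suc (suc n) * (suc n C suc r)
    ≡⟨ double (suc n C suc r) ⟩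
      2 * (suc r * (suc n C suc r))
    ≡⟨ cong (2 *_) (absorption n r) ⟩
      2 * (suc n * (n C r))
    ≡⟨ sym (*-assoc 2 (suc n) _) ⟩
      2 * (1 + 2 * r) * ((2 * r) C r)
    ∎
    where
    open ≡-Reasoning
    n = 2 * r
    [1+2r]∸r≡1+r : suc n ∸ r ≡ suc r
    [1+2r]∸r≡1+r = trans (cong (_∸ r) (1+2r≡[1+r]+r r)) (m+n∸n≡m (suc r) r)
      where
      1+2r≡[1+r]+r : ∀ r → suc (2 * r) ≡ suc r + r
      1+2r≡[1+r]+r = solve-∀
    symmetric : suc n C r ≡ suc n C suc r
    symmetric = trans (nCk≡nC[n∸k] (m≤n⇒m≤1+n (m≤m+n r (r + 0)))) (cong (suc n C_) [1+2r]∸r≡1+r)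
    double : ∀ c → suc (suc n) * c ≡ 2 * (suc r * c)
    double = double′ r
      where
      double′ : ∀ r c → (2 + 2 * r) * c ≡ 2 * (suc r * c)
      double′ = solve-∀

module Recurrence where

  open import Data.Nat
  open import Data.Nat.Properties
  open import Data.Nat.Combinatorics
  open import Data.Sum using (inj₁; inj₂)
  open import Relation.Binary.PropositionalEquality
  open import Data.Nat.Tactic.RingSolver using (solve-∀)
  open import Defs using (term; numer)
  open FiniteSum
  open Binomial

  T : ℕ → ℕ → ℕ
  T m k = 2 ^ k * ((2 * m ∸ 2 * k) C (m ∸ k)) * ((m + k) C k)

  -- 2^(2m) d_j(m), with the vanishing summands k < j included
  termSum : ℕ → ℕ → ℕ
  termSum j m = ∑[ k < suc m ] term m j k

  e : ℕ → ℕ → ℕ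
  e m j = (m + j) * (suc m ∸ j)

  certificate : ℕ → ℕ → ℕ → ℕ
  certificate m j k = j * (suc (2 * m) ∸ 2 * k) * (k C j) * T m k

  recurrence-lhs recurrence-rhs : ℕ → ℕ → ℕ → ℕ
  recurrence-lhs m p k = suc p * suc (suc p) * term m (suc (suc p)) k + e m (suc p) * term m p k
  recurrence-rhs m p k = suc (2 * m) * suc p * term m (suc p) k

  [1+m+n]∸m≡1+n : ∀ m n → suc (m + n) ∸ m ≡ suc n
  [1+m+n]∸m≡1+n m n = trans (+-∸-assoc 1 (m≤m+n m n)) (cong suc (m+n∸m≡n m n))

  [m+[1+n]]∸[1+m]≡n : ∀ m n → m + suc n ∸ suc m ≡ n
  [m+[1+n]]∸[1+m]≡n m n = trans (cong (_∸ suc m) (+-suc m n)) (m+n∸m≡n m n)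

  certificate-core-below : ∀ k r p →
    suc k * (suc p * suc (suc p) * 0 + e (k + suc r) (suc p) * 0 + suc p * (3 + 2 * r) * 0)
      ≡ suc k * (suc (2 * (k + suc r)) * suc p * 0) + suc r * suc p * ((k + suc r) + suc k) * (0 + 0)
  certificate-core-below k r p = zeros k r p (e (k + suc r) (suc p))
    where
    zeros : ∀ k r p x → suc k * (suc p * suc (suc p) * 0 + x * 0 + suc p * (3 + 2 * r) * 0)
      ≡ suc k * (suc (2 * (k + suc r)) * suc p * 0) + suc r * suc p * ((k + suc r) + suc k) * (0 + 0)
    zeros = solve-∀

  certificate-core-diagonal : ∀ p r →
    suc p * (suc p * suc (suc p) * 0 + ((p + suc r) + suc p) * suc r * 1 + suc p * (3 + 2 * r) * 0)
      ≡ suc p * (suc (2 * (p + suc r)) * suc p * 0) + suc r * suc p * ((p + suc r) + suc p) * (1 + 0)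
  certificate-core-diagonal = solve-∀

  certificate-core-above : ∀ p t r c₀ c₁ c₂ d →
    suc (suc p) * c₂ ≡ t * c₁ → suc p * c₁ ≡ suc t * c₀ → d ≡ suc t + suc r →
    let k = suc (p + t); m = k + suc r in
    suc k * (suc p * suc (suc p) * c₂ + (m + suc p) * d * c₀ + suc p * (3 + 2 * r) * c₁)
      ≡ suc k * (suc (2 * m) * suc p * c₁) + suc r * suc p * (m + suc k) * (c₀ + c₁)
  certificate-core-above p t r c₀ c₁ c₂ .(suc t + suc r) c₂-rel c₁-rel refl = begin
      suc k * (suc p * suc (suc p) * c₂ + (m + suc p) * (suc t + suc r) * c₀ + suc p * (3 + 2 * r) * c₁)
    ≡⟨ step₁ p t r c₀ c₁ c₂ ⟩
      suc k * (suc p * (suc (suc p) * c₂) + (m + suc p) * (suc t + suc r) * c₀ + (3 + 2 * r) * (suc p * c₁))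
    ≡⟨ cong (λ u → suc k * (suc p * u + (m + suc p) * (suc t + suc r) * c₀ + (3 + 2 * r) * (suc p * c₁))) c₂-rel ⟩
      suc k * (suc p * (t * c₁) + (m + suc p) * (suc t + suc r) * c₀ + (3 + 2 * r) * (suc p * c₁))
    ≡⟨ cong (λ u → suc k * (u + (m + suc p) * (suc t + suc r) * c₀ + (3 + 2 * r) * (suc p * c₁))) (x*[y*z]≡y*[x*z] (suc p) t c₁) ⟩
      suc k * (t * (suc p * c₁) + (m + suc p) * (suc t + suc r) * c₀ + (3 + 2 * r) * (suc p * c₁))
    ≡⟨ cong (λ u → suc k * (t * u + (m + suc p) * (suc t + suc r) * c₀ + (3 + 2 * r) * u)) c₁-rel ⟩
      suc k * (t * (suc t * c₀) + (m + suc p) * (suc t + suc r) * c₀ + (3 + 2 * r) * (suc t * c₀))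
    ≡⟨ step₂ p t r c₀ ⟩
      suc k * suc (2 * m) * (suc t * c₀) + suc r * (m + suc k) * (suc p * c₀ + suc t * c₀)
    ≡⟨ cong (λ u → suc k * suc (2 * m) * u + suc r * (m + suc k) * (suc p * c₀ + u)) (sym c₁-rel) ⟩
      suc k * suc (2 * m) * (suc p * c₁) + suc r * (m + suc k) * (suc p * c₀ + suc p * c₁)
    ≡⟨ step₃ p t r c₀ c₁ ⟩
      suc k * (suc (2 * m) * suc p * c₁) + suc r * suc p * (m + suc k) * (c₀ + c₁)
    ∎
    where
    open ≡-Reasoning
    k = suc (p + t)
    m = k + suc r
    step₁ : ∀ p t r c₀ c₁ c₂ → let k = suc (p + t); m = k + suc r in
      suc k * (suc p * suc (suc p) * c₂ + (m + suc p) * (suc t + suc r) * c₀ + suc p * (3 + 2 * r) * c₁)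
        ≡ suc k * (suc p * (suc (suc p) * c₂) + (m + suc p) * (suc t + suc r) * c₀ + (3 + 2 * r) * (suc p * c₁))
    step₁ = solve-∀
    x*[y*z]≡y*[x*z] : ∀ x y z → x * (y * z) ≡ y * (x * z)
    x*[y*z]≡y*[x*z] = solve-∀
    step₂ : ∀ p t r c₀ → let k = suc (p + t); m = k + suc r in
      suc k * (t * (suc t * c₀) + (m + suc p) * (suc t + suc r) * c₀ + (3 + 2 * r) * (suc t * c₀))
        ≡ suc k * suc (2 * m) * (suc t * c₀) + suc r * (m + suc k) * (suc p * c₀ + suc t * c₀)
    step₂ = solve-∀
    step₃ : ∀ p t r c₀ c₁ → let k = suc (p + t); m = k + suc r in
      suc k * suc (2 * m) * (suc p * c₁) + suc r * (m + suc k) * (suc p * c₀ + suc p * c₁)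
        ≡ suc k * (suc (2 * m) * suc p * c₁) + suc r * suc p * (m + suc k) * (c₀ + c₁)
    step₃ = solve-∀

  certificate-core : ∀ k r p → let m = k + suc r in
    suc k * (suc p * suc (suc p) * (k C suc (suc p)) + e m (suc p) * (k C p) + suc p * (3 + 2 * r) * (k C suc p))
      ≡ suc k * (suc (2 * m) * suc p * (k C suc p)) + suc r * suc p * (m + suc k) * (k C p + k C suc p)
  certificate-core k r p with compare k p
  certificate-core k r .(suc (k + s)) | less .k s
    rewrite k>n⇒nCk≡0 {k} {suc (k + s)} (s≤s (m≤m+n k s))
          | k>n⇒nCk≡0 {k} {suc (suc (k + s))} (m<n⇒m<1+n (s≤s (m≤m+n k s)))
          | k>n⇒nCk≡0 {k} {suc (suc (suc (k + s)))} (m<n⇒m<1+n (m<n⇒m<1+n (s≤s (m≤m+n k s))))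
    = certificate-core-below k r (suc (k + s))
  certificate-core k r .k | equal .k
    rewrite nCn≡1 k | k>n⇒nCk≡0 {k} {suc k} (n<1+n k) | k>n⇒nCk≡0 {k} {suc (suc k)} (m<n⇒m<1+n (n<1+n k))
          | m+n∸m≡n k (suc r)
    = certificate-core-diagonal k r
  certificate-core .(suc (p + t)) r p | greater .p t
    = certificate-core-above p t r (suc (p + t) C p) (suc (p + t) C suc p) (suc (p + t) C suc (suc p)) _
        c₂-rel c₁-rel m∸p≡1+t+1+r

    where
    m∸p≡1+t+1+r : suc (p + t) + suc r ∸ p ≡ suc t + suc r
    m∸p≡1+t+1+r = trans (cong (_∸ p) (+-assoc (suc p) t (suc r))) ([1+m+n]∸m≡1+n p (t + suc r))
    c₁-rel : suc p * (suc (p + t) C suc p) ≡ suc t * (suc (p + t) C p)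
    c₁-rel = trans ([k+1]*nC[k+1]≡[n∸k]*nCk (suc (p + t)) p) (cong (_* (suc (p + t) C p)) ([1+m+n]∸m≡1+n p t))
    c₂-rel : suc (suc p) * (suc (p + t) C suc (suc p)) ≡ t * (suc (p + t) C suc p)
    c₂-rel = trans ([k+1]*nC[k+1]≡[n∸k]*nCk (suc (p + t)) (suc p)) (cong (_* (suc (p + t) C suc p)) (m+n∸m≡n p t))

  ∸-by : ∀ {x} y z → x ≡ y + z → x ∸ y ≡ z
  ∸-by y z x≡y+z = trans (cong (_∸ y) x≡y+z) (m+n∸m≡n y z)

  -- For m = k + r + 1 one has T m k = X * Y₀ * Z₀ and T m (k + 1) = 2 * X * Y₁ * Z₁ (the hypotheses
  -- relate Y₀, Y₁ and Z₀, Z₁); multiplying by (r + 1)(k + 1) reduces the certificate identity to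
  -- the binomial identity in c₀, c₁, c₂ = C(k, p), C(k, p + 1), C(k, p + 2).
  certificate-step-from-core : ∀ X Y₀ Y₁ Z₀ Z₁ c₀ c₁ c₂ k r l m x →
    suc r * Y₀ ≡ 2 * (1 + 2 * r) * Y₁ →
    suc k * Z₁ ≡ (m + suc k) * Z₀ →
    suc k * (l * suc l * c₂ + x * c₀ + l * (3 + 2 * r) * c₁)
      ≡ suc k * (suc (2 * m) * l * c₁) + suc r * l * (m + suc k) * (c₀ + c₁) →
    l * suc l * (X * Y₀ * Z₀ * c₂) + x * (X * Y₀ * Z₀ * c₀) + l * (3 + 2 * r) * c₁ * (X * Y₀ * Z₀)
      ≡ suc (2 * m) * l * (X * Y₀ * Z₀ * c₁) + l * (1 + 2 * r) * (c₀ + c₁) * (2 * X * Y₁ * Z₁)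
  certificate-step-from-core X Y₀ Y₁ Z₀ Z₁ c₀ c₁ c₂ k r l m x Y-rel Z-rel core =
    *-cancelˡ-≡ _ _ (suc r * suc k) (begin
      suc r * suc k * (l * suc l * (X * Y₀ * Z₀ * c₂) + x * (X * Y₀ * Z₀ * c₀) + l * (3 + 2 * r) * c₁ * (X * Y₀ * Z₀))
    ≡⟨ step₁ X Y₀ Z₀ c₀ c₁ c₂ k r l x ⟩
      suc r * Y₀ * X * Z₀ * (suc k * (l * suc l * c₂ + x * c₀ + l * (3 + 2 * r) * c₁))
    ≡⟨ cong₂ (λ u w → u * X * Z₀ * w) Y-rel core ⟩
      2 * (1 + 2 * r) * Y₁ * X * Z₀ * (suc k * (suc (2 * m) * l * c₁) + suc r * l * (m + suc k) * (c₀ + c₁))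
    ≡⟨ step₂ X Y₁ Z₀ c₀ c₁ k r l m ⟩
      2 * (1 + 2 * r) * Y₁ * X * Z₀ * suc k * (suc (2 * m) * l * c₁)
        + l * (1 + 2 * r) * (c₀ + c₁) * (2 * X * Y₁ * ((m + suc k) * Z₀)) * suc r
    ≡⟨ cong₂ (λ u w → u * X * Z₀ * suc k * (suc (2 * m) * l * c₁) + l * (1 + 2 * r) * (c₀ + c₁) * (2 * X * Y₁ * w) * suc r)
             (sym Y-rel) (sym Z-rel) ⟩
      suc r * Y₀ * X * Z₀ * suc k * (suc (2 * m) * l * c₁)
        + l * (1 + 2 * r) * (c₀ + c₁) * (2 * X * Y₁ * (suc k * Z₁)) * suc r
    ≡⟨ step₃ X Y₀ Y₁ Z₀ Z₁ c₀ c₁ k r l m ⟩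
      suc r * suc k * (suc (2 * m) * l * (X * Y₀ * Z₀ * c₁) + l * (1 + 2 * r) * (c₀ + c₁) * (2 * X * Y₁ * Z₁))
    ∎)
    where
    open ≡-Reasoning
    step₁ : ∀ X Y₀ Z₀ c₀ c₁ c₂ k r l x →
      suc r * suc k * (l * suc l * (X * Y₀ * Z₀ * c₂) + x * (X * Y₀ * Z₀ * c₀) + l * (3 + 2 * r) * c₁ * (X * Y₀ * Z₀))
        ≡ suc r * Y₀ * X * Z₀ * (suc k * (l * suc l * c₂ + x * c₀ + l * (3 + 2 * r) * c₁))
    step₁ = solve-∀
    step₂ : ∀ X Y₁ Z₀ c₀ c₁ k r l m →
      2 * (1 + 2 * r) * Y₁ * X * Z₀ * (suc k * (suc (2 * m) * l * c₁) + suc r * l * (m + suc k) * (c₀ + c₁))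
        ≡ 2 * (1 + 2 * r) * Y₁ * X * Z₀ * suc k * (suc (2 * m) * l * c₁)
          + l * (1 + 2 * r) * (c₀ + c₁) * (2 * X * Y₁ * ((m + suc k) * Z₀)) * suc r
    step₂ = solve-∀
    step₃ : ∀ X Y₀ Y₁ Z₀ Z₁ c₀ c₁ k r l m →
      suc r * Y₀ * X * Z₀ * suc k * (suc (2 * m) * l * c₁)
        + l * (1 + 2 * r) * (c₀ + c₁) * (2 * X * Y₁ * (suc k * Z₁)) * suc r
        ≡ suc r * suc k * (suc (2 * m) * l * (X * Y₀ * Z₀ * c₁) + l * (1 + 2 * r) * (c₀ + c₁) * (2 * X * Y₁ * Z₁))
    step₃ = solve-∀

  2[k+1+r]≡2k+[2+2r] : ∀ k r → 2 * (k + suc r) ≡ 2 * k + (2 + 2 * r)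
  2[k+1+r]≡2k+[2+2r] = solve-∀

  2[k+1+r]≡2[1+k]+2r : ∀ k r → 2 * (k + suc r) ≡ 2 * suc k + 2 * r
  2[k+1+r]≡2[1+k]+2r = solve-∀

  1+2[k+1+r]≡2k+[3+2r] : ∀ k r → suc (2 * (k + suc r)) ≡ 2 * k + (3 + 2 * r)
  1+2[k+1+r]≡2k+[3+2r] = solve-∀

  1+2[k+1+r]≡2[1+k]+[1+2r] : ∀ k r → suc (2 * (k + suc r)) ≡ 2 * suc k + (1 + 2 * r)
  1+2[k+1+r]≡2[1+k]+[1+2r] = solve-∀

  absorption-shifted : ∀ n k → suc k * ((n + suc k) C suc k) ≡ (n + suc k) * ((n + k) C k)
  absorption-shifted n k = subst (λ x → suc k * (x C suc k) ≡ x * ((n + k) C k)) (sym (+-suc n k)) (absorption (n + k) k)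

  certificate-step-interior : ∀ k r p → let m = k + suc r in
    recurrence-lhs m p k + certificate m (suc p) k ≡ recurrence-rhs m p k + certificate m (suc p) (suc k)
  certificate-step-interior k r p
    rewrite m+n∸m≡n k (suc r) | ∸-by (2 * k) (2 + 2 * r) (2[k+1+r]≡2k+[2+2r] k r) | [m+[1+n]]∸[1+m]≡n k r
          | ∸-by (2 * suc k) (2 * r) (2[k+1+r]≡2[1+k]+2r k r) | ∸-by (2 * k) (3 + 2 * r) (1+2[k+1+r]≡2k+[3+2r] k r)
          | ∸-by (2 * suc k) (1 + 2 * r) (1+2[k+1+r]≡2[1+k]+[1+2r] k r) | sym (pascal k p)
    = certificate-step-from-core (2 ^ k) ((2 + 2 * r) C suc r) ((2 * r) C r) ((k + suc r + k) C k) ((k + suc r + suc k) C suc k)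
        (k C p) (k C suc p) (k C suc (suc p)) k r (suc p) (k + suc r) (e (k + suc r) (suc p))
        (central-binomial r) (absorption-shifted (k + suc r) k) (certificate-core k r p)

  [1+2m]∸2m≡1 : ∀ m → suc (2 * m) ∸ 2 * m ≡ 1
  [1+2m]∸2m≡1 m = ∸-by (2 * m) 1 (+-comm 1 (2 * m))

  [1+2m]∸2[1+m]≡0 : ∀ m → suc (2 * m) ∸ 2 * suc m ≡ 0
  [1+2m]∸2[1+m]≡0 m = m≤n⇒m∸n≡0 (≤-trans (n≤1+n (suc (2 * m))) (≤-reflexive (2+2m≡2[1+m] m)))
    where
    2+2m≡2[1+m] : ∀ m → 2 + 2 * m ≡ 2 * suc m
    2+2m≡2[1+m] = solve-∀

  certificate-core-last : ∀ p t c₀ c₁ c₂ d →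
    suc (suc p) * c₂ ≡ t * c₁ → suc p * c₁ ≡ suc t * c₀ → d ≡ suc t →
    let m = suc (p + t) in
    suc p * suc (suc p) * c₂ + (m + suc p) * d * c₀ + suc p * 1 * c₁ ≡ suc (2 * m) * suc p * c₁
  certificate-core-last p t c₀ c₁ c₂ .(suc t) c₂-rel c₁-rel refl = begin
      suc p * suc (suc p) * c₂ + (m + suc p) * suc t * c₀ + suc p * 1 * c₁
    ≡⟨ step₁ p t c₀ c₁ c₂ ⟩
      suc p * (suc (suc p) * c₂) + (m + suc p) * suc t * c₀ + suc p * c₁
    ≡⟨ cong (λ u → suc p * u + (m + suc p) * suc t * c₀ + suc p * c₁) c₂-rel ⟩
      suc p * (t * c₁) + (m + suc p) * suc t * c₀ + suc p * c₁
    ≡⟨ step₂ p t c₀ c₁ ⟩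
      suc t * (suc p * c₁) + (m + suc p) * suc t * c₀
    ≡⟨ cong (λ u → suc t * u + (m + suc p) * suc t * c₀) c₁-rel ⟩
      suc t * (suc t * c₀) + (m + suc p) * suc t * c₀
    ≡⟨ step₃ p t c₀ ⟩
      suc (2 * m) * (suc t * c₀)
    ≡⟨ cong (suc (2 * m) *_) (sym c₁-rel) ⟩
      suc (2 * m) * (suc p * c₁)
    ≡⟨ sym (*-assoc (suc (2 * m)) (suc p) c₁) ⟩
      suc (2 * m) * suc p * c₁
    ∎
    where
    open ≡-Reasoning
    m = suc (p + t)
    step₁ : ∀ p t c₀ c₁ c₂ → let m = suc (p + t) in
      suc p * suc (suc p) * c₂ + (m + suc p) * suc t * c₀ + suc p * 1 * c₁
        ≡ suc p * (suc (suc p) * c₂) + (m + suc p) * suc t * c₀ + suc p * c₁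
    step₁ = solve-∀
    step₂ : ∀ p t c₀ c₁ → let m = suc (p + t) in
      suc p * (t * c₁) + (m + suc p) * suc t * c₀ + suc p * c₁ ≡ suc t * (suc p * c₁) + (m + suc p) * suc t * c₀
    step₂ = solve-∀
    step₃ : ∀ p t c₀ → let m = suc (p + t) in
      suc t * (suc t * c₀) + (m + suc p) * suc t * c₀ ≡ suc (2 * m) * (suc t * c₀)
    step₃ = solve-∀

  certificate-step-last : ∀ p t → let m = suc (p + t) in
    recurrence-lhs m p m + certificate m (suc p) m ≡ recurrence-rhs m p m + certificate m (suc p) (suc m)
  certificate-step-last p t
    rewrite n∸n≡0 (2 * suc (p + t)) | n∸n≡0 (suc (p + t))
          | [1+2m]∸2m≡1 (suc (p + t)) | [1+2m]∸2[1+m]≡0 (suc (p + t))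
    = clear-T (suc p) (e m (suc p)) (suc (2 * m)) (m C p) (m C suc p) (m C suc (suc p))
        (2 ^ m * 1 * ((m + m) C m)) (suc m C suc p) (T m (suc m))
        (certificate-core-last p t (m C p) (m C suc p) (m C suc (suc p)) (m ∸ p) c₂-rel c₁-rel
          ([1+m+n]∸m≡1+n p t))
    where
    m = suc (p + t)
    c₁-rel : suc p * (m C suc p) ≡ suc t * (m C p)
    c₁-rel = trans ([k+1]*nC[k+1]≡[n∸k]*nCk m p) (cong (_* (m C p)) ([1+m+n]∸m≡1+n p t))
    c₂-rel : suc (suc p) * (m C suc (suc p)) ≡ t * (m C suc p)
    c₂-rel = trans ([k+1]*nC[k+1]≡[n∸k]*nCk m (suc p)) (cong (_* (m C suc p)) (m+n∸m≡n p t))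
    clear-T : ∀ l x R c₀ c₁ c₂ X y z → l * suc l * c₂ + x * c₀ + l * 1 * c₁ ≡ R * l * c₁ →
      l * suc l * (X * c₂) + x * (X * c₀) + l * 1 * c₁ * X ≡ R * l * (X * c₁) + l * 0 * y * z
    clear-T l x R c₀ c₁ c₂ X y z core =
      trans (factor l x X c₀ c₁ c₂) (trans (cong (X *_) core) (unfactor l R X c₁ y z))
      where
      factor : ∀ l x X c₀ c₁ c₂ → l * suc l * (X * c₂) + x * (X * c₀) + l * 1 * c₁ * X ≡ X * (l * suc l * c₂ + x * c₀ + l * 1 * c₁)
      factor = solve-∀
      unfactor : ∀ l R X c₁ y z → X * (R * l * c₁) ≡ R * l * (X * c₁) + l * 0 * y * z
      unfactor = solve-∀

  certificate-step : ∀ m p → suc p ≤ m → ∀ k → k < suc m →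
    recurrence-lhs m p k + certificate m (suc p) k ≡ recurrence-rhs m p k + certificate m (suc p) (suc k)
  certificate-step m p p<m k k<1+m with m<1+n⇒m<n∨m≡n k<1+m
  ... | inj₁ k<m =
    subst (λ m → recurrence-lhs m p k + certificate m (suc p) k ≡ recurrence-rhs m p k + certificate m (suc p) (suc k))
          (trans (+-suc k (m ∸ suc k)) (m+[n∸m]≡n k<m))
          (certificate-step-interior k (m ∸ suc k) p)
  ... | inj₂ refl =
    subst (λ m → recurrence-lhs m p m + certificate m (suc p) m ≡ recurrence-rhs m p m + certificate m (suc p) (suc m))
          (m+[n∸m]≡n p<m)
          (certificate-step-last p (k ∸ suc p))

  recurrence : ∀ m p → suc p ≤ m →
    suc p * suc (suc p) * termSum (suc (suc p)) m + e m (suc p) * termSum p m ≡ suc (2 * m) * suc p * termSum (suc p) m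
  recurrence m p p<m = begin
      a * termSum (suc (suc p)) m + b * termSum p m
    ≡⟨ sym (cong₂ _+_ (∑-*ˡ (suc m) a (term m (suc (suc p)))) (∑-*ˡ (suc m) b (term m p))) ⟩
      ∑[ k < suc m ] (a * term m (suc (suc p)) k) + ∑[ k < suc m ] (b * term m p k)
    ≡⟨ sym (∑-+ (suc m) (λ k → a * term m (suc (suc p)) k) (λ k → b * term m p k)) ⟩
      ∑ (suc m) (recurrence-lhs m p)
    ≡⟨ sym (+-identityʳ _) ⟩
      ∑ (suc m) (recurrence-lhs m p) + 0
    ≡⟨ cong (∑ (suc m) (recurrence-lhs m p) +_) (sym certificate-starts) ⟩
      ∑ (suc m) (recurrence-lhs m p) + certificate m (suc p) 0
    ≡⟨ telescoping (suc m) (recurrence-lhs m p) (recurrence-rhs m p) (certificate m (suc p)) (certificate-step m p p<m) ⟩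
      ∑ (suc m) (recurrence-rhs m p) + certificate m (suc p) (suc m)
    ≡⟨ cong (∑ (suc m) (recurrence-rhs m p) +_) certificate-vanishes ⟩
      ∑ (suc m) (recurrence-rhs m p) + 0
    ≡⟨ +-identityʳ _ ⟩
      ∑ (suc m) (recurrence-rhs m p)
    ≡⟨ ∑-*ˡ (suc m) (suc (2 * m) * suc p) (term m (suc p)) ⟩
      suc (2 * m) * suc p * termSum (suc p) m
    ∎
    where
    open ≡-Reasoning
    a = suc p * suc (suc p)
    b = e m (suc p)
    certificate-starts : certificate m (suc p) 0 ≡ 0
    certificate-starts = cong (_* T m 0) (*-zeroʳ (suc p * (suc (2 * m) ∸ 0)))
    certificate-vanishes : certificate m (suc p) (suc m) ≡ 0
    certificate-vanishes rewrite [1+2m]∸2[1+m]≡0 m | *-zeroʳ (suc p) = refl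

  term-below : ∀ m j k → k < j → term m j k ≡ 0
  term-below m j k k<j = trans (cong (T m k *_) (k>n⇒nCk≡0 k<j)) (*-zeroʳ (T m k))

  numer≡termSum : ∀ j m → j ≤ m → numer j m ≡ termSum j m
  numer≡termSum j m j≤m = begin
      numer j m
    ≡⟨ sum-map-applyUpTo (suc (m ∸ j)) (λ i → term m j (j + i)) (λ i → i) ⟩
      ∑[ i < suc (m ∸ j) ] term m j (j + i)
    ≡⟨ cong (_+ ∑[ i < suc (m ∸ j) ] term m j (j + i)) (sym (∑-zero j (term m j) (term-below m j))) ⟩
      ∑ j (term m j) + ∑[ i < suc (m ∸ j) ] term m j (j + i)
    ≡⟨ sym (∑-split j (suc (m ∸ j)) (term m j)) ⟩
      ∑ (j + suc (m ∸ j)) (term m j)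
    ≡⟨ cong (λ n → ∑ n (term m j)) (trans (+-suc j (m ∸ j)) (cong suc (m+[n∸m]≡n j≤m))) ⟩
      termSum j m
    ∎
    where open ≡-Reasoning

  termSum-vanishes : ∀ m → termSum (suc m) m ≡ 0
  termSum-vanishes m = ∑-zero (suc m) (term m (suc m)) (term-below m (suc m))

  termSum>0 : ∀ j m → j ≤ m → 0 < termSum j m
  termSum>0 j m j≤m = ≤-trans last-term>0 (≤-trans (m≤n+m _ (∑ m (term m j))) (≤-reflexive (sym last-term-split)))
    where
    last-term-split : termSum j m ≡ ∑ m (term m j) + term m j m
    last-term-split =
      trans (cong (λ n → ∑ n (term m j)) (+-comm 1 m))
            (trans (∑-split m 1 (term m j)) (cong (∑ m (term m j) +_) (trans (+-identityʳ _) (cong (term m j) (+-identityʳ m)))))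
    *-pos : ∀ {x y} → 0 < x → 0 < y → 0 < x * y
    *-pos {suc x} {suc y} _ _ = z<s
    last-term>0 : 0 < term m j m
    last-term>0 rewrite n∸n≡0 (2 * m) | n∸n≡0 m =
      *-pos (*-pos (*-pos (m^n>0 2 m) z<s) (nCk>0 (m + m) m (m≤m+n m m))) (nCk>0 m j j≤m)


module RatioBound where

  open import Data.Nat
  open import Data.Nat.Properties
  open import Data.Fin using (zero; suc)
  open import Data.Vec using ([]; _∷_)
  open import Data.Product using (_,_)
  open import Data.Unit using (tt)
  open import Relation.Binary.PropositionalEquality
  open import Data.Nat.Tactic.RingSolver using (solve-∀)
  open Polynomial using (Expr; var; con; _⊕_; _⊗_; ≤-by-coefficients)
  open Recurrence

  D : ℕ → ℕ → ℕ
  D j x = 2 * j * j + 3 * j + 2 * x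

  W : ℕ → ℕ → ℕ → ℕ
  W m j x = suc (m + j) * D j x + j * x

  Dₑ : ∀ {n} → Expr n → Expr n → Expr n
  Dₑ j x = con 2 ⊗ j ⊗ j ⊕ con 3 ⊗ j ⊕ con 2 ⊗ x

  Wₑ : ∀ {n} → Expr n → Expr n → Expr n → Expr n
  Wₑ m j x = (con 1 ⊕ (m ⊕ j)) ⊗ Dₑ j x ⊕ j ⊗ x

  RatioBound : ℕ → ℕ → Set
  RatioBound m i = suc i * W m (suc i) (m ∸ suc i) * termSum (suc i) m ≤ e m (suc i) * D (suc i) (m ∸ suc i) * termSum i m

  ratio-bound-last : ∀ i → RatioBound (suc i) i
  ratio-bound-last i =
    equality-case (suc i) (n∸n≡0 i) (m+n∸n≡m 1 i) (recurrence (suc i) i ≤-refl) (termSum-vanishes (suc i))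
    where
    equality-case : ∀ m {x y Fᵢ F₊ F₊₊} → x ≡ 0 → y ≡ 1 → m * suc m * F₊₊ + (m + m) * y * Fᵢ ≡ suc (2 * m) * m * F₊ →
      F₊₊ ≡ 0 → m * W m m x * F₊ ≤ (m + m) * y * D m x * Fᵢ
    equality-case m {Fᵢ = Fᵢ} {F₊} refl refl rec refl = ≤-reflexive (begin
        m * W m m 0 * F₊
      ≡⟨ expand m (D m 0) F₊ ⟩
        D m 0 * (suc (2 * m) * m * F₊)
      ≡⟨ cong (D m 0 *_) (sym rec) ⟩
        D m 0 * (m * suc m * 0 + (m + m) * 1 * Fᵢ)
      ≡⟨ collect m (D m 0) Fᵢ ⟩
        (m + m) * 1 * D m 0 * Fᵢ
      ∎)
      where
      open ≡-Reasoning
      expand : ∀ m d F → m * (suc (m + m) * d + m * 0) * F ≡ d * (suc (2 * m) * m * F)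
      expand = solve-∀
      collect : ∀ m d F → d * (m * suc m * 0 + (m + m) * 1 * F) ≡ (m + m) * 1 * d * F
      collect = solve-∀

  ratio-bound-step : ∀ j m D W D′ W′ e e′ F₋ F F₊ → 0 < W′ →
    j * suc j * F₊ + e * F₋ ≡ suc (2 * m) * j * F →
    suc j * W′ * F₊ ≤ e′ * D′ * F →
    W * W′ + D * e′ * D′ ≤ D * suc (2 * m) * W′ →
    j * W * F ≤ e * D * F₋
  ratio-bound-step j m D W D′ W′ e e′ F₋ F F₊ W′>0 rec bound poly =
    *-cancelˡ-≤ W′ {{>-nonZero W′>0}} (+-cancelˡ-≤ K _ _ (subst (_≤ K + W′ * (e * D * F₋)) (+-comm (W′ * (j * W * F)) K) chain))
    where
    open ≤-Reasoning
    K = D * j * (e′ * D′ * F)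
    chain : W′ * (j * W * F) + K ≤ K + W′ * (e * D * F₋)
    chain = begin
        W′ * (j * W * F) + K
      ≡⟨ step₁ j D W D′ W′ e′ F ⟩
        j * F * (W * W′ + D * e′ * D′)
      ≤⟨ *-monoʳ-≤ (j * F) poly ⟩
        j * F * (D * suc (2 * m) * W′)
      ≡⟨ step₂ j m D W′ F ⟩
        D * W′ * (suc (2 * m) * j * F)
      ≡⟨ cong (D * W′ *_) (sym rec) ⟩
        D * W′ * (j * suc j * F₊ + e * F₋)
      ≡⟨ step₃ j D W′ e F₋ F₊ ⟩
        D * j * (suc j * W′ * F₊) + W′ * (e * D * F₋)
      ≤⟨ +-monoˡ-≤ (W′ * (e * D * F₋)) (*-monoʳ-≤ (D * j) bound) ⟩
        K + W′ * (e * D * F₋)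
      ∎
      where
      step₁ : ∀ j D W D′ W′ e′ F → W′ * (j * W * F) + D * j * (e′ * D′ * F) ≡ j * F * (W * W′ + D * e′ * D′)
      step₁ = solve-∀
      step₂ : ∀ j m D W′ F → j * F * (D * suc (2 * m) * W′) ≡ D * W′ * (suc (2 * m) * j * F)
      step₂ = solve-∀
      step₃ : ∀ j D W′ e F₋ F₊ → D * W′ * (j * suc j * F₊ + e * F₋) ≡ D * j * (suc j * W′ * F₊) + W′ * (e * D * F₋)
      step₃ = solve-∀

  step-polynomial-at : ∀ a b x y → x ≡ suc a → y ≡ a → let j = 2 + b; m = suc j + a in
    W m j x * W m (suc j) y + D j x * ((m + suc j) * x) * D (suc j) y ≤ D j x * suc (2 * m) * W m (suc j) y
  step-polynomial-at a b .(suc a) .a refl refl = ≤-by-coefficients lhs rhs tt (a ∷ b ∷ [])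
    where
    aₑ bₑ jₑ mₑ : Expr 2
    aₑ = var zero
    bₑ = var (suc zero)
    jₑ = con 2 ⊕ bₑ
    mₑ = con 1 ⊕ jₑ ⊕ aₑ
    lhs rhs : Expr 2
    lhs = Wₑ mₑ jₑ (con 1 ⊕ aₑ) ⊗ Wₑ mₑ (con 1 ⊕ jₑ) aₑ
          ⊕ Dₑ jₑ (con 1 ⊕ aₑ) ⊗ ((mₑ ⊕ (con 1 ⊕ jₑ)) ⊗ (con 1 ⊕ aₑ)) ⊗ Dₑ (con 1 ⊕ jₑ) aₑ
    rhs = Dₑ jₑ (con 1 ⊕ aₑ) ⊗ (con 1 ⊕ con 2 ⊗ mₑ) ⊗ Wₑ mₑ (con 1 ⊕ jₑ) aₑ

  step-polynomial : ∀ m j → 2 ≤ j → suc j ≤ m →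
    W m j (m ∸ j) * W m (suc j) (m ∸ suc j) + D j (m ∸ j) * e m (suc j) * D (suc j) (m ∸ suc j)
      ≤ D j (m ∸ j) * suc (2 * m) * W m (suc j) (m ∸ suc j)
  step-polynomial m (suc zero) (s≤s ()) _
  step-polynomial m (suc (suc b)) _ j<m with m≤n⇒∃[o]m+o≡n j<m
  ... | a , refl = step-polynomial-at a b _ _ ([1+m+n]∸m≡1+n (2 + b) a) (m+n∸m≡n (3 + b) a)

  ratio-bound-from : ∀ s i m → 1 ≤ i → s + suc i ≡ m → RatioBound m i
  ratio-bound-from zero i .(suc i) _ refl = ratio-bound-last i
  ratio-bound-from (suc s) i m 1≤i s+2+i≡m =
    ratio-bound-step (suc i) m (D (suc i) (m ∸ suc i)) (W m (suc i) (m ∸ suc i))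
      (D (2 + i) (m ∸ (2 + i))) (W m (2 + i) (m ∸ (2 + i))) (e m (suc i)) (e m (2 + i))
      (termSum i m) (termSum (suc i) m) (termSum (2 + i) m)
      z<s (recurrence m i (≤-trans (n≤1+n _) 2+i≤m))
      (ratio-bound-from s (suc i) m z<s (trans (+-suc s (suc i)) s+2+i≡m))
      (step-polynomial m (suc i) (s≤s 1≤i) 2+i≤m)
    where
    2+i≤m : 2 + i ≤ m
    2+i≤m = subst (2 + i ≤_) s+2+i≡m (s≤s (m≤n+m (suc i) s))

  ratio-bound : ∀ m i → 1 ≤ i → suc i ≤ m → RatioBound m i
  ratio-bound m i 1≤i i<m = ratio-bound-from (m ∸ suc i) i m 1≤i (m∸n+n≡m i<m)


module LogConcavity where

  open import Data.Nat
  open import Data.Nat.Properties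
  open import Data.Fin using (zero; suc)
  open import Data.Vec using ([]; _∷_)
  open import Data.Product using (_,_)
  open import Data.Unit using (tt)
  open import Relation.Binary.PropositionalEquality
  open import Data.Nat.Tactic.RingSolver using (solve-∀)
  open Polynomial using (Expr; var; con; _⊕_; _⊗_; ≤-by-coefficients)
  open import Defs using (numer)
  open Recurrence
  open RatioBound

  -- The quadratic form A s² - c s t + B t² is positive at (s, t) = (V, Q) and increasing in s
  -- from there on (c Q ≤ 2 A V), so it stays positive whenever s / t ≥ V / Q.
  quadratic-form>0 : ∀ A B c Q V s t → 0 < t →
    c * Q * V + 1 ≤ A * V * V + B * Q * Q → c * Q ≤ 2 * A * V → V * t ≤ Q * s →
    c * (s * t) < A * (s * s) + B * (t * t)
  quadratic-form>0 A B c Q V s t t>0 at-V/Q increasing V*t≤Q*s =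
    *-cancelˡ-< (Q * Q) _ _ (begin-strict
        Q * Q * (c * (s * t))
      ≡⟨ step₁ c Q s t ⟩
        c * Q * t * (Q * s)
      ≡⟨ cong (c * Q * t *_) Qs≡Vt+u ⟩
        c * Q * t * (V * t + u)
      ≡⟨ step₂ c Q V t u ⟩
        c * Q * V * (t * t) + c * Q * (t * u)
      <⟨ +-monoˡ-< (c * Q * (t * u)) (m<m+n (c * Q * V * (t * t)) (*-mono-≤ t>0 t>0)) ⟩
        c * Q * V * (t * t) + t * t + c * Q * (t * u)
      ≡⟨ cong (_+ c * Q * (t * u)) (sym (*-suc-distrib (c * Q * V) (t * t))) ⟩
        (c * Q * V + 1) * (t * t) + c * Q * (t * u)
      ≤⟨ +-mono-≤ (*-monoˡ-≤ (t * t) at-V/Q) (*-monoˡ-≤ (t * u) increasing) ⟩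
        (A * V * V + B * Q * Q) * (t * t) + 2 * A * V * (t * u)
      ≤⟨ m≤m+n _ (A * (u * u)) ⟩
        (A * V * V + B * Q * Q) * (t * t) + 2 * A * V * (t * u) + A * (u * u)
      ≡⟨ step₃ A B Q V t u ⟩
        A * ((V * t + u) * (V * t + u)) + B * (Q * Q) * (t * t)
      ≡⟨ cong (λ z → A * (z * z) + B * (Q * Q) * (t * t)) (sym Qs≡Vt+u) ⟩
        A * ((Q * s) * (Q * s)) + B * (Q * Q) * (t * t)
      ≡⟨ step₄ A B Q s t ⟩
        Q * Q * (A * (s * s) + B * (t * t))
      ∎)
    where
    open ≤-Reasoning
    u = Q * s ∸ V * t
    Qs≡Vt+u : Q * s ≡ V * t + u
    Qs≡Vt+u = sym (m+[n∸m]≡n V*t≤Q*s)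
    step₁ : ∀ c Q s t → Q * Q * (c * (s * t)) ≡ c * Q * t * (Q * s)
    step₁ = solve-∀
    *-suc-distrib : ∀ x y → (x + 1) * y ≡ x * y + y
    *-suc-distrib = solve-∀
    step₂ : ∀ c Q V t u → c * Q * t * (V * t + u) ≡ c * Q * V * (t * t) + c * Q * (t * u)
    step₂ = solve-∀
    step₃ : ∀ A B Q V t u → (A * V * V + B * Q * Q) * (t * t) + 2 * A * V * (t * u) + A * (u * u)
                            ≡ A * ((V * t + u) * (V * t + u)) + B * (Q * Q) * (t * t)
    step₃ = solve-∀
    step₄ : ∀ A B Q s t → A * ((Q * s) * (Q * s)) + B * (Q * Q) * (t * t) ≡ Q * Q * (A * (s * s) + B * (t * t))
    step₄ = solve-∀

  log-concavity-criterion : ∀ l m e α β Q V n₀ n₁ n₂ → 0 < n₂ →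
    l * suc l * n₂ + e * n₀ ≡ suc (2 * m) * l * n₁ → V * n₂ ≤ Q * n₁ →
    suc (2 * m) * l * α * Q * V + 1 ≤ e * β * V * V + l * suc l * α * Q * Q →
    suc (2 * m) * l * α * Q ≤ 2 * (e * β) * V →
    n₀ * n₂ * α < n₁ * n₁ * β
  log-concavity-criterion l m e α β Q V n₀ n₁ n₂ n₂>0 rec ratio at-V/Q increasing =
    *-cancelˡ-< e _ _ (+-cancelʳ-< (B * (n₂ * n₂)) _ _ (begin-strict
        e * (n₀ * n₂ * α) + B * (n₂ * n₂)
      ≡⟨ step₁ l e α n₀ n₂ ⟩
        (l * suc l * n₂ + e * n₀) * (n₂ * α)
      ≡⟨ cong (_* (n₂ * α)) rec ⟩
        suc (2 * m) * l * n₁ * (n₂ * α)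
      ≡⟨ step₂ l m α n₁ n₂ ⟩
        suc (2 * m) * l * α * (n₁ * n₂)
      <⟨ quadratic-form>0 (e * β) B (suc (2 * m) * l * α) Q V n₁ n₂ n₂>0 at-V/Q increasing ratio ⟩
        e * β * (n₁ * n₁) + B * (n₂ * n₂)
      ≡⟨ cong (_+ B * (n₂ * n₂)) (step₃ e β n₁) ⟩
        e * (n₁ * n₁ * β) + B * (n₂ * n₂)
      ∎))
    where
    open ≤-Reasoning
    B = l * suc l * α
    step₁ : ∀ l e α n₀ n₂ → e * (n₀ * n₂ * α) + l * suc l * α * (n₂ * n₂) ≡ (l * suc l * n₂ + e * n₀) * (n₂ * α)
    step₁ = solve-∀
    step₂ : ∀ l m α n₁ n₂ → suc (2 * m) * l * n₁ * (n₂ * α) ≡ suc (2 * m) * l * α * (n₁ * n₂)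
    step₂ = solve-∀
    step₃ : ∀ e β n₁ → e * β * (n₁ * n₁) ≡ e * (n₁ * n₁ * β)
    step₃ = solve-∀

  α β : ℕ → ℕ → ℕ → ℕ
  α m l x = suc x * suc l * (m + l + l * l)
  β m l x = x * l * suc (m + l + l * l)

  Q : ℕ → ℕ → ℕ → ℕ → ℕ
  Q m l x w = (m + suc l) * x * D (suc l) w

  V : ℕ → ℕ → ℕ → ℕ
  V m l w = suc l * W m (suc l) w

  module _ (a b : ℕ) where

    private
      aₑ bₑ lₑ mₑ : Expr 2
      aₑ = var zero
      bₑ = var (suc zero)
      lₑ = con 1 ⊕ bₑ
      mₑ = con 1 ⊕ lₑ ⊕ aₑ

      αₑ βₑ Eₑ Qₑ Vₑ cₑ : Expr 2
      αₑ = (con 2 ⊕ aₑ) ⊗ (con 1 ⊕ lₑ) ⊗ (mₑ ⊕ lₑ ⊕ lₑ ⊗ lₑ)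
      βₑ = (con 1 ⊕ aₑ) ⊗ lₑ ⊗ (con 1 ⊕ (mₑ ⊕ lₑ ⊕ lₑ ⊗ lₑ))
      Eₑ = (mₑ ⊕ lₑ) ⊗ (con 2 ⊕ aₑ)
      Qₑ = (mₑ ⊕ (con 1 ⊕ lₑ)) ⊗ (con 1 ⊕ aₑ) ⊗ Dₑ (con 1 ⊕ lₑ) aₑ
      Vₑ = (con 1 ⊕ lₑ) ⊗ Wₑ mₑ (con 1 ⊕ lₑ) aₑ
      cₑ = (con 1 ⊕ con 2 ⊗ mₑ) ⊗ lₑ ⊗ αₑ

    quadratic-at-ratio-bound : ∀ x y w → x ≡ suc a → y ≡ suc (suc a) → w ≡ a → let l = suc b; m = suc l + a in
      suc (2 * m) * l * α m l x * Q m l x w * V m l w + 1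
        ≤ (m + l) * y * β m l x * V m l w * V m l w + l * suc l * α m l x * Q m l x w * Q m l x w
    quadratic-at-ratio-bound .(suc a) .(suc (suc a)) .a refl refl refl =
      ≤-by-coefficients (cₑ ⊗ Qₑ ⊗ Vₑ ⊕ con 1) (Eₑ ⊗ βₑ ⊗ Vₑ ⊗ Vₑ ⊕ lₑ ⊗ (con 1 ⊕ lₑ) ⊗ αₑ ⊗ Qₑ ⊗ Qₑ) tt (a ∷ b ∷ [])

    quadratic-increasing : ∀ x y w → x ≡ suc a → y ≡ suc (suc a) → w ≡ a → let l = suc b; m = suc l + a in
      suc (2 * m) * l * α m l x * Q m l x w ≤ 2 * ((m + l) * y * β m l x) * V m l w
    quadratic-increasing .(suc a) .(suc (suc a)) .a refl refl refl =
      ≤-by-coefficients (cₑ ⊗ Qₑ) (con 2 ⊗ (Eₑ ⊗ βₑ) ⊗ Vₑ) tt (a ∷ b ∷ [])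

  termSum-log-concave : ∀ m b → 2 + b ≤ m →
    termSum b m * termSum (2 + b) m * α m (suc b) (m ∸ suc b) < termSum (suc b) m * termSum (suc b) m * β m (suc b) (m ∸ suc b)
  termSum-log-concave m b 2+b≤m with m≤n⇒∃[o]m+o≡n 2+b≤m
  ... | a , refl =
    log-concavity-criterion (suc b) m (e m (suc b)) (α m (suc b) x) (β m (suc b) x) (Q m (suc b) x w) (V m (suc b) w)
      (termSum b m) (termSum (suc b) m) (termSum (2 + b) m)
      (termSum>0 (2 + b) m 2+b≤m) (recurrence m b (≤-trans (n≤1+n (suc b)) 2+b≤m)) (ratio-bound m (suc b) z<s 2+b≤m)
      (quadratic-at-ratio-bound a b x y w x≡1+a y≡2+a w≡a) (quadratic-increasing a b x y w x≡1+a y≡2+a w≡a)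
    where
    x = m ∸ suc b
    y = m ∸ b
    w = m ∸ suc (suc b)
    x≡1+a : x ≡ suc a
    x≡1+a = [1+m+n]∸m≡1+n (suc b) a
    y≡2+a : y ≡ suc (suc a)
    y≡2+a = trans (cong (λ n → suc n ∸ b) (sym (+-suc b a))) ([1+m+n]∸m≡1+n b (suc a))
    w≡a : w ≡ a
    w≡a = m+n∸m≡n (2 + b) a

  numer-log-concave : ∀ m b → 2 + b ≤ m →
    numer b m * numer (2 + b) m * α m (suc b) (m ∸ suc b) < numer (suc b) m * numer (suc b) m * β m (suc b) (m ∸ suc b)
  numer-log-concave m b 2+b≤m
    rewrite numer≡termSum b m (≤-trans (n≤1+n b) (≤-trans (n≤1+n (suc b)) 2+b≤m))
          | numer≡termSum (suc b) m (≤-trans (n≤1+n (suc b)) 2+b≤m)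
          | numer≡termSum (2 + b) m 2+b≤m
    = termSum-log-concave m b 2+b≤m


module FromNatural where

  open import Data.Nat as ℕ using (ℕ; suc)
  import Data.Nat.Properties as ℕ
  open import Data.Integer as ℤ using (+_; +<+)
  import Data.Integer.Properties as ℤ
  open import Data.Rational using (_<_; _*_; _/_; toℚᵘ)
  open import Data.Rational.Properties using (toℚᵘ-fromℚᵘ; toℚᵘ-homo-*; toℚᵘ-cancel-<)
  open import Data.Rational.Unnormalised as U using (ℚᵘ; mkℚᵘ; *<*)
  import Data.Rational.Unnormalised.Properties as U
  open import Relation.Binary.PropositionalEquality
  open import Defs using (ι)

  toℚᵘ-/ : ∀ i n .{{_ : ℕ.NonZero n}} → toℚᵘ (i / n) U.≃ mkℚᵘ i (ℕ.pred n)
  toℚᵘ-/ i (suc n) = toℚᵘ-fromℚᵘ (mkℚᵘ i n)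

  +-* : ∀ x y → + x ℤ.* + y ≡ + (x ℕ.* y)
  +-* x y = sym (ℤ.pos-* x y)

  -- Over ℚᵘ both sides are fractions with the same denominator D²,
  -- so the comparison reduces to their numerators.
  cross-multiplied-< : ∀ n₀ n₁ n₂ a₁ a₂ a₃ b₁ b₂ b₃ D .{{_ : ℕ.NonZero D}} →
    n₀ ℕ.* n₂ ℕ.* (a₁ ℕ.* a₂ ℕ.* a₃) ℕ.< n₁ ℕ.* n₁ ℕ.* (b₁ ℕ.* b₂ ℕ.* b₃) →
    ((+ n₀ / D) * (+ n₂ / D)) * (ι a₁ * ι a₂ * ι a₃) < ((+ n₁ / D) * (+ n₁ / D)) * (ι b₁ * ι b₂ * ι b₃)
  cross-multiplied-< n₀ n₁ n₂ a₁ a₂ a₃ b₁ b₂ b₃ (suc d) nat-< =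
    toℚᵘ-cancel-< (U.<-respˡ-≃ (U.≃-sym (toℚᵘ-≃ n₀ n₂ a₁ a₂ a₃)) (U.<-respʳ-≃ (U.≃-sym (toℚᵘ-≃ n₁ n₁ b₁ b₂ b₃)) fractions-<))
    where
    D = suc d
    fraction : ℕ → ℕ → ℕ → ℕ → ℕ → ℚᵘ
    fraction n n′ c₁ c₂ c₃ = (mkℚᵘ (+ n) d U.* mkℚᵘ (+ n′) d) U.* (mkℚᵘ (+ c₁) 0 U.* mkℚᵘ (+ c₂) 0 U.* mkℚᵘ (+ c₃) 0)
    toℚᵘ-≃ : ∀ n n′ c₁ c₂ c₃ →
      toℚᵘ (((+ n / D) * (+ n′ / D)) * (ι c₁ * ι c₂ * ι c₃)) U.≃ fraction n n′ c₁ c₂ c₃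
    toℚᵘ-≃ n n′ c₁ c₂ c₃ =
      U.≃-trans (toℚᵘ-homo-* (q * q′) (ι c₁ * ι c₂ * ι c₃))
        (U.*-cong (U.≃-trans (toℚᵘ-homo-* q q′) (U.*-cong (toℚᵘ-/ (+ n) D) (toℚᵘ-/ (+ n′) D)))
                  (U.≃-trans (toℚᵘ-homo-* (ι c₁ * ι c₂) (ι c₃))
                     (U.*-cong (U.≃-trans (toℚᵘ-homo-* (ι c₁) (ι c₂)) (U.*-cong (toℚᵘ-/ (+ c₁) 1) (toℚᵘ-/ (+ c₂) 1)))
                               (toℚᵘ-/ (+ c₃) 1))))
      where
      q = + n / D
      q′ = + n′ / D
    numerator : ∀ n n′ c₁ c₂ c₃ → U.↥ fraction n n′ c₁ c₂ c₃ ≡ + (n ℕ.* n′ ℕ.* (c₁ ℕ.* c₂ ℕ.* c₃))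
    numerator n n′ c₁ c₂ c₃ =
      trans (cong₂ ℤ._*_ (+-* n n′) (trans (cong (ℤ._* + c₃) (+-* c₁ c₂)) (+-* (c₁ ℕ.* c₂) c₃))) (+-* (n ℕ.* n′) _)
    D² = D ℕ.* D ℕ.* (1 ℕ.* 1 ℕ.* 1)
    NL = n₀ ℕ.* n₂ ℕ.* (a₁ ℕ.* a₂ ℕ.* a₃)
    NR = n₁ ℕ.* n₁ ℕ.* (b₁ ℕ.* b₂ ℕ.* b₃)
    fractions-< : fraction n₀ n₂ a₁ a₂ a₃ U.< fraction n₁ n₁ b₁ b₂ b₃
    fractions-< = *<* (subst₂ ℤ._<_ (trans (sym (+-* NL D²)) (cong (ℤ._* + D²) (sym (numerator n₀ n₂ a₁ a₂ a₃))))
                            (trans (sym (+-* NR D²)) (cong (ℤ._* + D²) (sym (numerator n₁ n₁ b₁ b₂ b₃))))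
                            (+<+ (ℕ.*-monoˡ-< D² nat-<)))


open import Defs
open import Data.Nat using (ℕ; suc; _≤_; _∸_; s≤s; z≤n; _^_)
import Data.Nat as ℕ
open import Data.Nat.Properties using (m^n≢0)
open import Data.Rational using (ℚ; _<_; _*_)

theorem3p4 : (m ℓ : ℕ) → 2 ≤ m → 1 ≤ ℓ → ℓ ≤ m ∸ 1 →
    (d (ℓ ∸ 1) m * d (suc ℓ) m)
        * (ι (suc (m ∸ ℓ)) * ι (suc ℓ) * ι (m ℕ.+ ℓ ℕ.+ ℓ ℕ.* ℓ))
      < (d ℓ m * d ℓ m)
        * (ι (m ∸ ℓ) * ι ℓ * ι (suc (m ℕ.+ ℓ ℕ.+ ℓ ℕ.* ℓ)))
theorem3p4 (suc m) (suc b) _ (s≤s z≤n) b<m =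
  FromNatural.cross-multiplied-< (numer b M) (numer (suc b) M) (numer (2 ℕ.+ b) M)
    (suc (M ∸ suc b)) (suc (suc b)) (M ℕ.+ suc b ℕ.+ suc b ℕ.* suc b)
    (M ∸ suc b) (suc b) (suc (M ℕ.+ suc b ℕ.+ suc b ℕ.* suc b))
    (2 ^ (2 ℕ.* M)) {{m^n≢0 2 (2 ℕ.* M)}}
    (LogConcavity.numer-log-concave M b (s≤s b<m))
  where
  M = suc m
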